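{- Let $k\geq 2$ be an integer and $P_n$ the path on $n$ vertices. Then $\mathrm{girth}(\mathsf{TS}_k(P_n))=4$ for every $n\geq 2k+1$, and $\mathrm{girth}(\mathsf{TS}_k(P_n))=\infty$ for every $n\le 2k$. Consequently, $\mathrm{girth}(\mathsf{TS}(P_n))=4$ for every $n\geq 5$ and $\mathrm{girth}(\mathsf{TS}(P_n))=\infty$ for every $n\leq 4$.
   Context: All graphs are finite, simple and undirected. The girth of a graph is the length of a shortest cycle, and $\infty$ if it has no cycle. An independent set of a graph is a set of pairwise non-adjacent vertices. For a positive integer $k$, $\mathsf{TS}_k(G)$ is the graph whose vertices are the independent sets of $G$ of size exactly $k$, and $\mathsf{TS}(G)$ is the graph whose vertices are all non-empty independent sets of $G$; in both, two sets $I,J$ are adjacent iff there exist $u,v\in V(G)$ with $I\setminus J=\{u\}$, $J\setminus I=\{v\}$ and $uv\in E(G)$. -}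

module Defs where

open import Data.Nat using (ℕ; zero; suc; _<_; _≤_; _∸_)
open import Data.Fin using (Fin; toℕ)
open import Data.Fin.Subset using (Subset; _∈_; _─_; ⁅_⁆; ∣_∣; Nonempty)
open import Data.Product using (Σ; ∃; ∃-syntax; _×_; _,_)
open import Data.Sum using (_⊎_)
open import Data.Unit using (⊤)
open import Relation.Nullary using (¬_)
open import Relation.Binary.PropositionalEquality using (_≡_)

record Graph : Set₁ where
  field
    Carrier : Set
    Vertex  : Carrier → Set
    Adj     : Carrier → Carrier → Set
open Graph public

record Cycle (G : Graph) (m : ℕ) : Set where
  field
    len≥3    : 3 ≤ m
    vtx      : ℕ → Carrier G
    isVertex : ∀ i → i < m → Vertex G (vtx i)
    distinct : ∀ i j → i < m → j < m → vtx i ≡ vtx j → i ≡ j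
    step     : ∀ i → suc i < m → Adj G (vtx i) (vtx (suc i))
    close    : Adj G (vtx (m ∸ 1)) (vtx 0)

data ℕ∞ : Set where
  fin : ℕ → ℕ∞
  ∞   : ℕ∞

HasGirth : Graph → ℕ∞ → Set
HasGirth G (fin g) = Cycle G g × (∀ m → m < g → ¬ Cycle G m)
HasGirth G ∞       = ∀ m → ¬ Cycle G m

P : ℕ → Graph
P n = record
  { Carrier = Fin n
  ; Vertex  = λ _ → ⊤
  ; Adj     = λ i j → (toℕ j ≡ suc (toℕ i)) ⊎ (toℕ i ≡ suc (toℕ j))
  }

Independent : {n : ℕ} → (Fin n → Fin n → Set) → Subset n → Set
Independent adj I = ∀ u v → u ∈ I → v ∈ I → ¬ adj u v

TSAdj : {n : ℕ} → (Fin n → Fin n → Set) → Subset n → Subset n → Set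
TSAdj adj I J = ∃[ u ] ∃[ v ] ((I ─ J) ≡ ⁅ u ⁆ × (J ─ I) ≡ ⁅ v ⁆ × adj u v)

TSₖ : {n : ℕ} → (Fin n → Fin n → Set) → ℕ → Graph
TSₖ {n} adj k = record
  { Carrier = Subset n
  ; Vertex  = λ I → Independent adj I × ∣ I ∣ ≡ k
  ; Adj     = TSAdj adj
  }

TS : {n : ℕ} → (Fin n → Fin n → Set) → Graph
TS {n} adj = record
  { Carrier = Subset n
  ; Vertex  = λ I → Independent adj I × Nonempty I
  ; Adj     = TSAdj adj
  }

-- Sliding a token along an edge of P_n keeps the number of tokens and moves
-- the sum of the token positions by exactly one.  So the parity of that sum
-- alternates along every walk in TS(P_n), which rules out triangles.  If
-- n ≤ 2k, an independent k-set of P_n is determined by its position sum (for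
-- n = 2k these sets are {0, 2, …, 2i-2, 2i+1, 2i+3, …, 2k-1}).  On a cycle, a
-- vertex of maximal position sum has two distinct neighbours, both with the
-- same size and with position sum one less, which is then impossible.  For
-- TS(P_n) with n ≤ 4 the same holds because the sets have size 1 or 2.
-- Conversely, for n ≥ 2k+1 the sets {0,3}, {1,3}, {1,4}, {0,4}, completed by
-- k-2 tokens at 6, 8, …, form a 4-cycle.

module Submission where

open import Defs
open import Data.Nat
open import Data.Nat.Properties
open import Data.Nat.Tactic.RingSolver using (solve-∀)
open import Data.Parity.Base using (_⁻¹)
open import Data.Parity.Properties using (p≢p⁻¹; ⁻¹-involutive; ⁻¹-selfInverse; suc-homo-⁻¹)
open import Algebra.Properties.CommutativeSemigroup +-commutativeSemigroup using (interchange)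
open import Data.Bool using (Bool; true; false)
open import Data.Vec using ([]; _∷_)
open import Data.Vec.Base using (here; there)
open import Data.Fin using (Fin; toℕ) renaming (zero to fzero; suc to fsuc)
open import Data.Fin.Properties using (toℕ-injective)
open import Data.Fin.Subset using (Subset; _∈_; _─_; ⁅_⁆; ∣_∣; Nonempty) renaming (⊥ to ∅)
open import Data.Fin.Subset.Properties using (∣⊥∣≡0; ∣⁅x⁆∣≡1; ∉⊥)
open import Data.Product using (∃-syntax; ∃₂; _×_; _,_)
open import Data.Sum using (_⊎_; inj₁; inj₂; swap) renaming (map to ⊎-map)
open import Function using (_∘_)
open import Relation.Nullary using (¬_; yes; no; contradiction)
open import Relation.Binary.PropositionalEquality

Consecutive : ℕ → ℕ → Set
Consecutive a b = b ≡ suc a ⊎ a ≡ suc b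

consecutive-sym : ∀ {a b} → Consecutive a b → Consecutive b a
consecutive-sym = swap

consecutive-parity : ∀ {a b} → Consecutive a b → parity b ≡ parity a ⁻¹
consecutive-parity {a} (inj₁ refl) = sym (⁻¹-selfInverse (suc-homo-⁻¹ a))
consecutive-parity {b = b} (inj₂ refl) = sym (suc-homo-⁻¹ b)

consecutive-shift : ∀ {a b u v} → a + v ≡ b + u → Consecutive u v → Consecutive a b
consecutive-shift {a} {b} {u} e (inj₁ refl) =
  inj₁ (+-cancelʳ-≡ u b (suc a) (trans (sym e) (+-suc a u)))
consecutive-shift {a} {b} {v = v} e (inj₂ refl) =
  inj₂ (+-cancelʳ-≡ v a (suc b) (trans e (+-suc b v)))

consecutive∧≤⇒≡1+ : ∀ {a b} → Consecutive a b → b ≤ a → a ≡ suc b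
consecutive∧≤⇒≡1+ (inj₁ refl) b≤a = contradiction b≤a 1+n≰n
consecutive∧≤⇒≡1+ (inj₂ a≡1+b) _ = a≡1+b

+-cancelˡ-≡′ : ∀ {a b x y} → a ≡ b → a + x ≡ b + y → x ≡ y
+-cancelˡ-≡′ {a} refl = +-cancelˡ-≡ a _ _

argmax : (f : ℕ → ℕ) (m : ℕ) → ∃[ i ] i < suc m × (∀ j → j < suc m → f j ≤ f i)
argmax f zero = zero , z<s , λ { zero _ → ≤-refl ; (suc _) (s≤s ()) }
argmax f (suc m) with argmax f m
... | i , i<1+m , max with f (suc m) ≤? f i
...   | yes fm≤fi = i , m<n⇒m<1+n i<1+m , λ j j< → bound j (m<1+n⇒m<n∨m≡n j<)
  where
  bound : ∀ j → j < suc m ⊎ j ≡ suc m → f j ≤ f i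
  bound j (inj₁ j<1+m) = max j j<1+m
  bound _ (inj₂ refl) = fm≤fi
...   | no fm≰fi = suc m , ≤-refl , λ j j< → bound j (m<1+n⇒m<n∨m≡n j<)
  where
  bound : ∀ j → j < suc m ⊎ j ≡ suc m → f j ≤ f (suc m)
  bound j (inj₁ j<1+m) = ≤-trans (max j j<1+m) (<⇒≤ (≰⇒> fm≰fi))
  bound _ (inj₂ refl) = ≤-refl

Linked : (G : Graph) → Carrier G → Carrier G → Set
Linked G x y = Adj G x y ⊎ Adj G y x

cycle-neighbours : ∀ {G m} (C : Cycle G m) → ∀ i → i < m →
  ∃₂ λ p q → p < m × q < m × p ≢ q
           × Linked G (Cycle.vtx C i) (Cycle.vtx C p) × Linked G (Cycle.vtx C i) (Cycle.vtx C q)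
cycle-neighbours {m = 1} C _ _ = contradiction (Cycle.len≥3 C) λ { (s≤s ()) }
cycle-neighbours {m = 2} C _ _ = contradiction (Cycle.len≥3 C) λ { (s≤s (s≤s ())) }
cycle-neighbours {m = suc (suc (suc k))} C zero _ =
  1 , suc (suc k) , s≤s z<s , ≤-refl , (λ ()) , inj₁ (step 0 (s≤s z<s)) , inj₂ close
  where open Cycle C
cycle-neighbours {m = suc (suc (suc k))} C (suc j) 1+j<m with suc (suc j) <? suc (suc (suc k))
... | yes 2+j<m = j , suc (suc j) , <-trans (n<1+n j) 1+j<m , 2+j<m ,
                  <⇒≢ (m<n⇒m<1+n (n<1+n j)) , inj₂ (step j 1+j<m) , inj₁ (step (suc j) 2+j<m)
  where open Cycle C
... | no 2+j≮m with ≤-antisym (≤-pred (≤-pred 1+j<m)) (≤-pred (≤-pred (≤-pred (≰⇒> 2+j≮m))))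
...   | refl = suc k , 0 , s≤s (s≤s (n≤1+n k)) , z<s , (λ ()) ,
               inj₂ (step (suc k) ≤-refl) , inj₁ close
  where open Cycle C

-- Graphs graded by a height that changes by one along every edge

module Graded (G : Graph) (height : Carrier G → ℕ)
  (graded : ∀ {x y} → Vertex G x → Vertex G y → Adj G x y → Consecutive (height x) (height y)) where

  linked-consecutive : ∀ {x y} → Vertex G x → Vertex G y → Linked G x y →
                       Consecutive (height x) (height y)
  linked-consecutive vx vy (inj₁ xy) = graded vx vy xy
  linked-consecutive vx vy (inj₂ yx) = consecutive-sym (graded vy vx yx)

  no-triangle : ¬ Cycle G 3
  no-triangle C = p≢p⁻¹ (parity a) (begin
    parity a          ≡⟨ consecutive-parity (graded v₂ v₀ close) ⟩
    parity c ⁻¹       ≡⟨ cong _⁻¹ (consecutive-parity (graded v₁ v₂ (step 1 ≤-refl))) ⟩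
    parity b ⁻¹ ⁻¹    ≡⟨ ⁻¹-involutive (parity b) ⟩
    parity b          ≡⟨ consecutive-parity (graded v₀ v₁ (step 0 (s≤s z<s))) ⟩
    parity a ⁻¹       ∎)
    where
    open Cycle C
    open ≡-Reasoning
    a = height (vtx 0)
    b = height (vtx 1)
    c = height (vtx 2)
    v₀ = isVertex 0 z<s
    v₁ = isVertex 1 (s≤s z<s)
    v₂ = isVertex 2 ≤-refl

  no-cycle<4 : ∀ m → m < 4 → ¬ Cycle G m
  no-cycle<4 m m<4 C = no-triangle (subst (Cycle G) (≤-antisym (≤-pred m<4) (Cycle.len≥3 C)) C)

  acyclic : (invariant : Carrier G → ℕ) →
    (∀ {x y} → Vertex G x → Vertex G y → Adj G x y → invariant x ≡ invariant y) →
    (∀ {x y} → Vertex G x → Vertex G y →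
       invariant x ≡ invariant y → height x ≡ height y → x ≡ y) →
    HasGirth G ∞
  acyclic invariant preserved separated zero C = contradiction (Cycle.len≥3 C) λ ()
  acyclic invariant preserved separated (suc m) C
    with argmax (height ∘ Cycle.vtx C) m
  ... | i , i<m , max with cycle-neighbours C i i<m
  ...   | p , q , p<m , q<m , p≢q , i~p , i~q =
    p≢q (distinct p q p<m q<m (separated (isVertex p p<m) (isVertex q q<m)
          (trans (sym (same-invariant p<m i~p)) (same-invariant q<m i~q))
          (suc-injective (trans (sym (one-below p<m i~p)) (one-below q<m i~q)))))
    where
    open Cycle C
    one-below : ∀ {j} → j < suc m → Linked G (vtx i) (vtx j) → height (vtx i) ≡ suc (height (vtx j))
    one-below {j} j<m i~j =
      consecutive∧≤⇒≡1+ (linked-consecutive (isVertex i i<m) (isVertex j j<m) i~j) (max j j<m)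
    same-invariant : ∀ {j} → j < suc m → Linked G (vtx i) (vtx j) →
                     invariant (vtx i) ≡ invariant (vtx j)
    same-invariant {j} j<m (inj₁ ij) = preserved (isVertex i i<m) (isVertex j j<m) ij
    same-invariant {j} j<m (inj₂ ji) = sym (preserved (isVertex j j<m) (isVertex i i<m) ji)

-- positionSum p is the sum of the members of p: prepending an entry moves
-- every member of p one position up.
positionSum : ∀ {n} → Subset n → ℕ
positionSum []      = 0
positionSum (_ ∷ p) = ∣ p ∣ + positionSum p

p─p≡∅ : ∀ {n} (p : Subset n) → p ─ p ≡ ∅
p─p≡∅ []          = refl
p─p≡∅ (true ∷ p)  = cong (false ∷_) (p─p≡∅ p)
p─p≡∅ (false ∷ p) = cong (false ∷_) (p─p≡∅ p)

∣p∣≡0⇒p≡∅ : ∀ {n} {p : Subset n} → ∣ p ∣ ≡ 0 → p ≡ ∅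
∣p∣≡0⇒p≡∅ {p = []}        _ = refl
∣p∣≡0⇒p≡∅ {p = false ∷ p} e = cong (false ∷_) (∣p∣≡0⇒p≡∅ e)

nonempty⇒∣p∣≢0 : ∀ {n} {p : Subset n} → Nonempty p → ∣ p ∣ ≢ 0
nonempty⇒∣p∣≢0 (x , x∈p) ∣p∣≡0 = ∉⊥ (subst (x ∈_) (∣p∣≡0⇒p≡∅ ∣p∣≡0) x∈p)

∣p∣≡suc⇒nonempty : ∀ {n c} {p : Subset n} → ∣ p ∣ ≡ suc c → Nonempty p
∣p∣≡suc⇒nonempty {p = true ∷ p}  _ = fzero , here
∣p∣≡suc⇒nonempty {p = false ∷ p} e with ∣p∣≡suc⇒nonempty {p = p} e
... | x , x∈p = fsuc x , there x∈p

∣p∣≡1⇒p≡⁅x⁆ : ∀ {n} {p : Subset n} → ∣ p ∣ ≡ 1 → ∃[ x ] p ≡ ⁅ x ⁆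
∣p∣≡1⇒p≡⁅x⁆ {p = true ∷ p}  e = fzero , cong (true ∷_) (∣p∣≡0⇒p≡∅ (suc-injective e))
∣p∣≡1⇒p≡⁅x⁆ {p = false ∷ p} e with ∣p∣≡1⇒p≡⁅x⁆ {p = p} e
... | x , refl = fsuc x , refl

positionSum-∅ : ∀ n → positionSum (∅ {n}) ≡ 0
positionSum-∅ zero    = refl
positionSum-∅ (suc n) = cong₂ _+_ (∣⊥∣≡0 n) (positionSum-∅ n)

positionSum-⁅⁆ : ∀ {n} (x : Fin n) → positionSum ⁅ x ⁆ ≡ toℕ x
positionSum-⁅⁆ {suc n} fzero = cong₂ _+_ (∣⊥∣≡0 n) (positionSum-∅ n)
positionSum-⁅⁆ (fsuc x)      = cong₂ _+_ (∣⁅x⁆∣≡1 x) (positionSum-⁅⁆ x)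

∣∣-exchange : ∀ {n} (p q : Subset n) → ∣ p ∣ + ∣ q ─ p ∣ ≡ ∣ q ∣ + ∣ p ─ q ∣
∣∣-exchange []          []          = refl
∣∣-exchange (true ∷ p)  (true ∷ q)  = cong suc (∣∣-exchange p q)
∣∣-exchange (true ∷ p)  (false ∷ q) = trans (cong suc (∣∣-exchange p q)) (sym (+-suc _ _))
∣∣-exchange (false ∷ p) (true ∷ q)  = trans (+-suc _ _) (cong suc (∣∣-exchange p q))
∣∣-exchange (false ∷ p) (false ∷ q) = ∣∣-exchange p q

positionSum-exchange : ∀ {n} (p q : Subset n) →
  positionSum p + positionSum (q ─ p) ≡ positionSum q + positionSum (p ─ q)
positionSum-exchange [] [] = refl
positionSum-exchange (_ ∷ p) (_ ∷ q) = begin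
  (∣ p ∣ + positionSum p) + (∣ q ─ p ∣ + positionSum (q ─ p))
    ≡⟨ interchange (∣ p ∣) (positionSum p) (∣ q ─ p ∣) (positionSum (q ─ p)) ⟩
  (∣ p ∣ + ∣ q ─ p ∣) + (positionSum p + positionSum (q ─ p))
    ≡⟨ cong₂ _+_ (∣∣-exchange p q) (positionSum-exchange p q) ⟩
  (∣ q ∣ + ∣ p ─ q ∣) + (positionSum q + positionSum (p ─ q))
    ≡⟨ interchange (∣ q ∣) (∣ p ─ q ∣) (positionSum q) (positionSum (p ─ q)) ⟩
  (∣ q ∣ + positionSum q) + (∣ p ─ q ∣ + positionSum (p ─ q)) ∎
  where open ≡-Reasoning

slide-preserves-∣∣ : ∀ {n} {adj : Fin n → Fin n → Set} {I J : Subset n} →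
                     TSAdj adj I J → ∣ I ∣ ≡ ∣ J ∣
slide-preserves-∣∣ {I = I} {J} (u , v , I─J≡u , J─I≡v , _) = +-cancelʳ-≡ 1 ∣ I ∣ ∣ J ∣ (begin
  ∣ I ∣ + 1          ≡⟨ cong (∣ I ∣ +_) (trans (sym (∣⁅x⁆∣≡1 v)) (cong ∣_∣ (sym J─I≡v))) ⟩
  ∣ I ∣ + ∣ J ─ I ∣  ≡⟨ ∣∣-exchange I J ⟩
  ∣ J ∣ + ∣ I ─ J ∣  ≡⟨ cong (∣ J ∣ +_) (trans (cong ∣_∣ I─J≡u) (∣⁅x⁆∣≡1 u)) ⟩
  ∣ J ∣ + 1          ∎)
  where open ≡-Reasoning

slide-positionSum : ∀ {n} {I J : Subset n} → TSAdj (Adj (P n)) I J →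
                    Consecutive (positionSum I) (positionSum J)
slide-positionSum {I = I} {J} (u , v , I─J≡u , J─I≡v , u~v) = consecutive-shift (begin
  positionSum I + toℕ v            ≡⟨ cong (positionSum I +_) (trans (sym (positionSum-⁅⁆ v))
                                                                      (cong positionSum (sym J─I≡v))) ⟩
  positionSum I + positionSum (J ─ I) ≡⟨ positionSum-exchange I J ⟩
  positionSum J + positionSum (I ─ J) ≡⟨ cong (positionSum J +_) (trans (cong positionSum I─J≡u)
                                                                      (positionSum-⁅⁆ u)) ⟩
  positionSum J + toℕ u            ∎) u~v
  where open ≡-Reasoning

-- Independent sets of paths

data Sparse : ∀ {n} → Subset n → Set where
  nil  : Sparse []
  skip : ∀ {n} {p : Subset n} → Sparse p → Sparse (false ∷ p)
  last : Sparse (true ∷ [])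
  pick : ∀ {n} {p : Subset n} → Sparse p → Sparse (true ∷ false ∷ p)

sparse-no-successor : ∀ {n} {p : Subset n} → Sparse p →
                      ∀ {u v} → u ∈ p → v ∈ p → toℕ v ≢ suc (toℕ u)
sparse-no-successor (skip s) (there u∈p) (there v∈p) e = sparse-no-successor s u∈p v∈p (suc-injective e)
sparse-no-successor (pick s) {fzero} {fzero}          _ _ ()
sparse-no-successor (pick s) {fzero} {fsuc (fsuc v)}  _ _ ()
sparse-no-successor (pick s) {fsuc (fsuc u)} {fsuc (fsuc v)} (there (there u∈p)) (there (there v∈p)) e =
  sparse-no-successor s u∈p v∈p (suc-injective (suc-injective e))
sparse-no-successor (pick s) {fzero} {fsuc fzero}     _ (there ())
sparse-no-successor (pick s) {fsuc fzero}             (there ()) _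
sparse-no-successor (pick s) {fsuc (fsuc u)} {fsuc fzero} _ (there ())

sparse⇒independent : ∀ {n} {p : Subset n} → Sparse p → Independent (Adj (P n)) p
sparse⇒independent s u v u∈p v∈p (inj₁ e) = sparse-no-successor s u∈p v∈p e
sparse⇒independent s u v u∈p v∈p (inj₂ e) = sparse-no-successor s v∈p u∈p e

independent-tail : ∀ {n x} {p : Subset n} → Independent (Adj (P (suc n))) (x ∷ p) →
                   Independent (Adj (P n)) p
independent-tail ind u v u∈p v∈p u~v =
  ind (fsuc u) (fsuc v) (there u∈p) (there v∈p) (⊎-map (cong suc) (cong suc) u~v)

independent⇒sparse : ∀ {n} {p : Subset n} → Independent (Adj (P n)) p → Sparse p
independent⇒sparse {p = []}                ind = nil
independent⇒sparse {p = true ∷ []}         ind = last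
independent⇒sparse {p = false ∷ p}         ind = skip (independent⇒sparse (independent-tail ind))
independent⇒sparse {p = true ∷ true ∷ p}   ind =
  contradiction (inj₁ refl) (ind fzero (fsuc fzero) here (there here))
independent⇒sparse {p = true ∷ false ∷ p}  ind =
  pick (independent⇒sparse (independent-tail (independent-tail ind)))

sparse-∣∣-bound : ∀ {n} {p : Subset n} → Sparse p → ∣ p ∣ + ∣ p ∣ ≤ suc n
sparse-∣∣-bound nil      = z≤n
sparse-∣∣-bound (skip s) = m≤n⇒m≤1+n (sparse-∣∣-bound s)
sparse-∣∣-bound last     = s≤s (s≤s z≤n)
sparse-∣∣-bound {p = true ∷ false ∷ p} (pick s) =
  s≤s (≤-trans (≤-reflexive (+-suc ∣ p ∣ ∣ p ∣)) (s≤s (sparse-∣∣-bound s)))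

-- With c = ∣ p ∣ members, the position sum of a sparse p lies between
-- 0 + 2 + ⋯ + 2(c-1) = c² - c and (n-1) + (n-3) + ⋯ = c n - c².
sparse-positionSum-≥ : ∀ {n} {p : Subset n} → Sparse p →
                       ∣ p ∣ * ∣ p ∣ ≤ positionSum p + ∣ p ∣
sparse-positionSum-≥ nil = z≤n
sparse-positionSum-≥ {p = false ∷ p} (skip s) =
  ≤-trans (sparse-positionSum-≥ s) (+-monoˡ-≤ ∣ p ∣ (m≤n+m (positionSum p) ∣ p ∣))
sparse-positionSum-≥ last = s≤s z≤n
sparse-positionSum-≥ {p = true ∷ false ∷ p} (pick s) = begin
  suc c * suc c                         ≡⟨ square-suc c ⟩
  c * c + (c + suc c)                   ≤⟨ +-monoˡ-≤ (c + suc c) (sparse-positionSum-≥ s) ⟩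
  positionSum p + c + (c + suc c)       ≡⟨ regroup c (positionSum p) ⟩
  c + (c + positionSum p) + suc c       ∎
  where
  open ≤-Reasoning
  c = ∣ p ∣
  square-suc : ∀ c → suc c * suc c ≡ c * c + (c + suc c)
  square-suc = solve-∀
  regroup : ∀ c s → s + c + (c + suc c) ≡ c + (c + s) + suc c
  regroup = solve-∀

sparse-positionSum-≤ : ∀ {n} {p : Subset n} → Sparse p →
                       positionSum p + ∣ p ∣ * ∣ p ∣ ≤ ∣ p ∣ * n
sparse-positionSum-≤ nil = z≤n
sparse-positionSum-≤ {suc n} {false ∷ p} (skip s) = begin
  c + positionSum p + c * c      ≡⟨ +-assoc c (positionSum p) (c * c) ⟩
  c + (positionSum p + c * c)    ≤⟨ +-monoʳ-≤ c (sparse-positionSum-≤ s) ⟩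
  c + c * n                      ≡⟨ *-suc c n ⟨
  c * suc n                      ∎
  where
  open ≤-Reasoning
  c = ∣ p ∣
sparse-positionSum-≤ last = s≤s z≤n
sparse-positionSum-≤ {suc (suc n)} {true ∷ false ∷ p} (pick s) = begin
  c + (c + positionSum p) + suc c * suc c      ≡⟨ regroup c (positionSum p) ⟩
  positionSum p + c * c + (c + c + (c + c + 1)) ≤⟨ +-mono-≤ (sparse-positionSum-≤ s)
                                                   (+-monoʳ-≤ (c + c) (+-monoˡ-≤ 1 (sparse-∣∣-bound s))) ⟩
  c * n + (c + c + (suc n + 1))                ≡⟨ expand c n ⟨
  suc c * suc (suc n)                          ∎
  where
  open ≤-Reasoning
  c = ∣ p ∣
  regroup : ∀ c s → c + (c + s) + suc c * suc c ≡ s + c * c + (c + c + (c + c + 1))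
  regroup = solve-∀
  expand : ∀ c n → suc c * suc (suc n) ≡ c * n + (c + c + (suc n + 1))
  expand = solve-∀

halve : ∀ {n c} → suc (suc n) ≤ suc c + suc c → n ≤ c + c
halve {c = c} 2+n≤ = ≤-pred (≤-pred (≤-trans 2+n≤ (≤-reflexive (cong suc (+-suc c c)))))

-- When n ≤ 2k, a sparse k-set avoiding position 0 is {1, 3, …, 2k-1}, whose
-- sum k² exceeds that of every sparse k-set containing 0.
positionSum-pick<skip : ∀ {n} {p : Subset (suc n)} {q : Subset n} → Sparse p → Sparse q →
  ∣ p ∣ ≡ suc ∣ q ∣ → n ≤ ∣ q ∣ + ∣ q ∣ →
  positionSum (true ∷ false ∷ q) < positionSum (false ∷ p)
positionSum-pick<skip {n} {p} {q} sp sq ∣p∣≡ n≤2c = begin-strict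
  c + (c + positionSum q)  <⟨ below-square (≤-trans (sparse-positionSum-≤ sq) (*-monoʳ-≤ c n≤2c)) ⟩
  suc c * suc c            ≡⟨ cong (λ x → x * x) ∣p∣≡ ⟨
  ∣ p ∣ * ∣ p ∣            ≤⟨ sparse-positionSum-≥ sp ⟩
  positionSum p + ∣ p ∣    ≡⟨ +-comm (positionSum p) ∣ p ∣ ⟩
  ∣ p ∣ + positionSum p    ∎
  where
  open ≤-Reasoning
  c = ∣ q ∣
  below-square : ∀ {s} → s + c * c ≤ c * (c + c) → c + (c + s) < suc c * suc c
  below-square {s} le = +-cancelʳ-≤ (c * c) _ _ (begin
    suc (c + (c + s)) + c * c  ≡⟨ lhs c s ⟩
    s + c * c + suc (c + c)    ≤⟨ +-monoˡ-≤ (suc (c + c)) le ⟩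
    c * (c + c) + suc (c + c)  ≡⟨ rhs c ⟩
    suc c * suc c + c * c      ∎)
    where
    lhs : ∀ c s → suc (c + (c + s)) + c * c ≡ s + c * c + suc (c + c)
    lhs = solve-∀
    rhs : ∀ c → c * (c + c) + suc (c + c) ≡ suc c * suc c + c * c
    rhs = solve-∀

positionSum-injective : ∀ {n} {p q : Subset n} → n ≤ ∣ p ∣ + ∣ p ∣ → Sparse p → Sparse q →
  ∣ p ∣ ≡ ∣ q ∣ → positionSum p ≡ positionSum q → p ≡ q
positionSum-injective _ nil nil _ _ = refl
positionSum-injective _ last last _ _ = refl
positionSum-injective _ last (skip nil) () _
positionSum-injective _ (skip nil) last () _
positionSum-injective n≤2c (skip sp) (skip sq) ∣p∣≡∣q∣ Σ≡ =
  cong (false ∷_)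
    (positionSum-injective (≤-trans (n≤1+n _) n≤2c) sp sq ∣p∣≡∣q∣ (+-cancelˡ-≡′ ∣p∣≡∣q∣ Σ≡))
positionSum-injective n≤2c (pick sp) (pick sq) ∣p∣≡∣q∣ Σ≡ =
  cong (λ r → true ∷ false ∷ r)
    (positionSum-injective (halve n≤2c) sp sq c≡ (+-cancelˡ-≡′ c≡ (+-cancelˡ-≡′ c≡ Σ≡)))
  where c≡ = suc-injective ∣p∣≡∣q∣
positionSum-injective n≤2c (skip sp) (pick sq) ∣p∣≡∣q∣ Σ≡ =
  contradiction
    (positionSum-pick<skip sp sq ∣p∣≡∣q∣ (halve (subst (λ c → _ ≤ c + c) ∣p∣≡∣q∣ n≤2c)))
    (<-irrefl (sym Σ≡))
positionSum-injective n≤2c (pick sp) (skip sq) ∣p∣≡∣q∣ Σ≡ =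
  contradiction (positionSum-pick<skip sq sp (sym ∣p∣≡∣q∣) (halve n≤2c)) (<-irrefl Σ≡)

positionSum-injective-singleton : ∀ {n} {p q : Subset n} → ∣ p ∣ ≡ 1 → ∣ q ∣ ≡ 1 →
  positionSum p ≡ positionSum q → p ≡ q
positionSum-injective-singleton {p = p} {q} ∣p∣≡1 ∣q∣≡1 Σ≡
  with ∣p∣≡1⇒p≡⁅x⁆ {p = p} ∣p∣≡1 | ∣p∣≡1⇒p≡⁅x⁆ {p = q} ∣q∣≡1
... | x , refl | y , refl =
  cong ⁅_⁆ (toℕ-injective (trans (sym (positionSum-⁅⁆ x)) (trans Σ≡ (positionSum-⁅⁆ y))))

positionSum-injective-≤4 : ∀ {n} {p q : Subset n} → n ≤ 4 → Sparse p → Sparse q → Nonempty p →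
  ∣ p ∣ ≡ ∣ q ∣ → positionSum p ≡ positionSum q → p ≡ q
positionSum-injective-≤4 {n} {p} {q} n≤4 sp sq ne ∣p∣≡∣q∣ Σ≡ = by-size ∣ p ∣ refl
  where
  by-size : ∀ c → ∣ p ∣ ≡ c → p ≡ q
  by-size 0 ∣p∣≡0 = contradiction ∣p∣≡0 (nonempty⇒∣p∣≢0 ne)
  by-size 1 ∣p∣≡1 = positionSum-injective-singleton ∣p∣≡1 (trans (sym ∣p∣≡∣q∣) ∣p∣≡1) Σ≡
  by-size 2 ∣p∣≡2 =
    positionSum-injective (≤-trans n≤4 (≤-reflexive (sym (cong₂ _+_ ∣p∣≡2 ∣p∣≡2)))) sp sq ∣p∣≡∣q∣ Σ≡
  by-size (suc (suc (suc c))) ∣p∣≡3+c = contradiction (begin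
    6                              ≤⟨ +-mono-≤ (m≤m+n 3 c) (m≤m+n 3 c) ⟩
    (3 + c) + (3 + c)              ≡⟨ cong₂ _+_ ∣p∣≡3+c ∣p∣≡3+c ⟨
    ∣ p ∣ + ∣ p ∣                  ≤⟨ sparse-∣∣-bound sp ⟩
    suc n                          ≤⟨ s≤s n≤4 ⟩
    5                              ∎) (n≮n 5)
    where open ≤-Reasoning

-- A 4-cycle in token sliding graphs of paths

padLength : ℕ → ℕ → ℕ
padLength zero    r = r
padLength (suc j) r = suc (suc (padLength j r))

padLength≡ : ∀ j r → padLength j r ≡ j + j + r
padLength≡ zero    r = refl
padLength≡ (suc j) r = trans (cong (suc ∘ suc) (padLength≡ j r)) (shift j r)
  where
  shift : ∀ j r → suc (suc (j + j + r)) ≡ suc j + suc j + r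
  shift = solve-∀

padding : ∀ j r → Subset (padLength j r)
padding zero    r = ∅
padding (suc j) r = false ∷ true ∷ padding j r

∣padding∣≡ : ∀ j r → ∣ padding j r ∣ ≡ j
∣padding∣≡ zero    r = ∣⊥∣≡0 r
∣padding∣≡ (suc j) r = cong suc (∣padding∣≡ j r)

∅-sparse : ∀ n → Sparse (∅ {n})
∅-sparse zero    = nil
∅-sparse (suc n) = skip (∅-sparse n)

true∷padding-sparse : ∀ j r → Sparse (true ∷ padding j r)
true∷padding-sparse zero    zero    = last
true∷padding-sparse zero    (suc r) = pick (∅-sparse r)
true∷padding-sparse (suc j) r       = pick (true∷padding-sparse j r)

sparse-tail : ∀ {n} {p : Subset n} → Sparse (true ∷ p) → Sparse p
sparse-tail last     = nil
sparse-tail (pick s) = skip s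

module Square {m} (pad : Subset m) (true∷pad-sparse : Sparse (true ∷ pad)) where

  prefix : Bool → Bool → Bool → Bool → Bool → Subset m → Subset (5 + m)
  prefix a b c d e w = a ∷ b ∷ c ∷ d ∷ e ∷ w

  corner : ℕ → Subset (5 + m)
  corner 0 = prefix true  false false true  false pad
  corner 1 = prefix false true  false true  false pad
  corner 2 = prefix false true  false false true  pad
  corner _ = prefix true  false false false true  pad

  corner-sparse : ∀ i → Sparse (corner i)
  corner-sparse 0                   = pick (skip (pick (sparse-tail true∷pad-sparse)))
  corner-sparse 1                   = skip (pick (pick (sparse-tail true∷pad-sparse)))
  corner-sparse 2                   = skip (pick (skip true∷pad-sparse))
  corner-sparse (suc (suc (suc _))) = pick (skip (skip true∷pad-sparse))

  corner-size : ∀ i → ∣ corner i ∣ ≡ 2 + ∣ pad ∣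
  corner-size 0                   = refl
  corner-size 1                   = refl
  corner-size 2                   = refl
  corner-size (suc (suc (suc _))) = refl

  label : Subset (5 + m) → ℕ
  label (_ ∷ false ∷ _ ∷ _ ∷ false ∷ _) = 0
  label (_ ∷ true  ∷ _ ∷ _ ∷ false ∷ _) = 1
  label (_ ∷ true  ∷ _ ∷ _ ∷ true  ∷ _) = 2
  label (_ ∷ false ∷ _ ∷ _ ∷ true  ∷ _) = 3

  label-corner : ∀ i → i < 4 → label (corner i) ≡ i
  label-corner 0 _ = refl
  label-corner 1 _ = refl
  label-corner 2 _ = refl
  label-corner 3 _ = refl
  label-corner (suc (suc (suc (suc _)))) (s≤s (s≤s (s≤s (s≤s ()))))

  unchanged-pad : ∀ a b c d e → prefix a b c d e (pad ─ pad) ≡ prefix a b c d e ∅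
  unchanged-pad a b c d e = cong (prefix a b c d e) (p─p≡∅ pad)

  slidingGraph : (Subset (5 + m) → Set) → Graph
  slidingGraph V = record { Carrier = Subset (5 + m) ; Vertex = V ; Adj = TSAdj (Adj (P (5 + m))) }

  square : (V : Subset (5 + m) → Set) → (∀ i → V (corner i)) → Cycle (slidingGraph V) 4
  square V corner-vertex = record
    { len≥3    = s≤s (s≤s (s≤s z≤n))
    ; vtx      = corner
    ; isVertex = λ i _ → corner-vertex i
    ; distinct = λ i j i<4 j<4 e →
                   trans (sym (label-corner i i<4)) (trans (cong label e) (label-corner j j<4))
    ; step     = slide
    ; close    = fsuc (fsuc (fsuc (fsuc fzero))) , fsuc (fsuc (fsuc fzero)) ,
                 unchanged-pad false false false false true , unchanged-pad false false false true false ,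
                 inj₂ refl
    }
    where
    slide : ∀ i → suc i < 4 → TSAdj (Adj (P (5 + m))) (corner i) (corner (suc i))
    slide 0 _ = fzero , fsuc fzero ,
                unchanged-pad true false false false false , unchanged-pad false true false false false ,
                inj₁ refl
    slide 1 _ = fsuc (fsuc (fsuc fzero)) , fsuc (fsuc (fsuc (fsuc fzero))) ,
                unchanged-pad false false false true false , unchanged-pad false false false false true ,
                inj₁ refl
    slide 2 _ = fsuc fzero , fzero ,
                unchanged-pad false true false false false , unchanged-pad true false false false false ,
                inj₂ refl
    slide (suc (suc (suc _))) (s≤s (s≤s (s≤s (s≤s ()))))

TSₖ-girth-4 : ∀ k → 2 ≤ k → ∀ n → 2 * k + 1 ≤ n → HasGirth (TSₖ (Adj (P n)) k) (fin 4)
TSₖ-girth-4 k@(suc (suc j)) (s≤s (s≤s z≤n)) n 2k+1≤n with m≤n⇒∃[o]m+o≡n 2k+1≤n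
... | r , refl =
  subst (λ N → Cycle (TSₖ (Adj (P N)) k) 4) (length≡ j r) (square V corner-vertex) ,
  Graded.no-cycle<4 (TSₖ (Adj (P n)) k) positionSum (λ _ _ → slide-positionSum)
  where
  open Square (padding j r) (true∷padding-sparse j r)
  V : Subset (5 + padLength j r) → Set
  V I = Independent (Adj (P (5 + padLength j r))) I × ∣ I ∣ ≡ k
  corner-vertex : ∀ i → V (corner i)
  corner-vertex i =
    sparse⇒independent (corner-sparse i) , trans (corner-size i) (cong (2 +_) (∣padding∣≡ j r))
  length≡ : ∀ j r → 5 + padLength j r ≡ 2 * suc (suc j) + 1 + r
  length≡ j r = trans (cong (5 +_) (padLength≡ j r)) (regroup j r)
    where
    regroup : ∀ j r → 5 + (j + j + r) ≡ 2 * suc (suc j) + 1 + r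
    regroup = solve-∀

TSₖ-acyclic : ∀ k n → n ≤ 2 * k → HasGirth (TSₖ (Adj (P n)) k) ∞
TSₖ-acyclic k n n≤2k =
  Graded.acyclic (TSₖ (Adj (P n)) k) positionSum (λ _ _ → slide-positionSum)
    ∣_∣ (λ _ _ → slide-preserves-∣∣)
    λ { (ind-x , ∣x∣≡k) (ind-y , _) ∣∣≡ Σ≡ →
        positionSum-injective (subst (λ c → n ≤ c + c) (sym ∣x∣≡k) n≤k+k)
          (independent⇒sparse ind-x) (independent⇒sparse ind-y) ∣∣≡ Σ≡ }
  where
  n≤k+k : n ≤ k + k
  n≤k+k = ≤-trans n≤2k (≤-reflexive (cong (k +_) (+-identityʳ k)))

TS-girth-4 : ∀ n → 5 ≤ n → HasGirth (TS (Adj (P n))) (fin 4)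
TS-girth-4 n 5≤n with m≤n⇒∃[o]m+o≡n 5≤n
... | r , refl =
  square V (λ i → sparse⇒independent (corner-sparse i) , ∣p∣≡suc⇒nonempty (corner-size i)) ,
  Graded.no-cycle<4 (TS (Adj (P n))) positionSum (λ _ _ → slide-positionSum)
  where
  open Square (padding 0 r) (true∷padding-sparse 0 r)
  V : Subset (5 + r) → Set
  V I = Independent (Adj (P (5 + r))) I × Nonempty I

TS-acyclic : ∀ n → n ≤ 4 → HasGirth (TS (Adj (P n))) ∞
TS-acyclic n n≤4 =
  Graded.acyclic (TS (Adj (P n))) positionSum (λ _ _ → slide-positionSum)
    ∣_∣ (λ _ _ → slide-preserves-∣∣)
    λ { (ind-x , x-nonempty) (ind-y , _) ∣∣≡ Σ≡ →
        positionSum-injective-≤4 n≤4 (independent⇒sparse ind-x) (independent⇒sparse ind-y)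
          x-nonempty ∣∣≡ Σ≡ }

proposition13 :
    (∀ k → 2 ≤ k →
      (∀ n → 2 * k + 1 ≤ n → HasGirth (TSₖ (Adj (P n)) k) (fin 4))
      × (∀ n → n ≤ 2 * k → HasGirth (TSₖ (Adj (P n)) k) ∞))
    × (∀ n → 5 ≤ n → HasGirth (TS (Adj (P n))) (fin 4))
    × (∀ n → n ≤ 4 → HasGirth (TS (Adj (P n))) ∞)
proposition13 = (λ k 2≤k → TSₖ-girth-4 k 2≤k , TSₖ-acyclic k) , TS-girth-4 , TS-acyclic
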